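{- Let $t\ge 1$. If $G$ is any 2-tree on $3t$ vertices, then $G(3t)$ contains $G$ as a subgraph.
   Context: A simple graph $G$ is a 2-tree if $G=K_3$, or $G$ has a vertex $v$ of degree 2 whose two neighbors are adjacent and $G-v$ is a 2-tree. $G(3t)$ is the graph obtained from $K_{2t}$ on vertices $v_1,\ldots,v_{2t}$ by adding new vertices $x_1,\ldots,x_t$ and joining $x_i$ to $v_1,\ldots,v_{2i}$ for $1\le i\le t$. -}

module Defs where

open import Data.Nat using (ℕ; suc; _+_; _*_; _∸_; _<_; _≤_)
open import Data.Nat.Properties using (<-irrefl; ≤⇒≯)
open import Data.Fin using (Fin; toℕ; punchIn)
open import Data.Product using (_×_; _,_; Σ)
open import Data.Sum using (_⊎_; inj₁; inj₂)
open import Relation.Nullary using (¬_)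
open import Relation.Binary.PropositionalEquality using (_≡_; _≢_; refl; sym)
open import Function.Definitions using (Injective)

record Graph (n : ℕ) : Set₁ where
  field
    E      : Fin n → Fin n → Set
    E-sym  : ∀ {i j} → E i j → E j i
    E-irr  : ∀ i → ¬ E i i
open Graph public

delete : ∀ {n} → Graph (suc n) → Fin (suc n) → Graph n
delete G v = record
  { E     = λ i j → E G (punchIn v i) (punchIn v j)
  ; E-sym = E-sym G
  ; E-irr = λ i → E-irr G (punchIn v i)
  }

Degree2With : ∀ {n} → Graph n → Fin n → Fin n → Fin n → Set
Degree2With G v a b =
  a ≢ b × E G v a × E G v b × (∀ w → E G v w → w ≡ a ⊎ w ≡ b)

data TwoTree : ∀ {n} → Graph n → Set₁ where
  isK3 : (G : Graph 3) → (∀ i j → i ≢ j → E G i j) → TwoTree G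
  step : ∀ {n} (G : Graph (suc n)) (v a b : Fin (suc n)) →
         Degree2With G v a b → E G a b → TwoTree (delete G v) → TwoTree G

SubgraphOf : ∀ {m n} → Graph m → Graph n → Set
SubgraphOf {m} {n} G H =
  Σ (Fin m → Fin n) λ f → Injective _≡_ _≡_ f × (∀ i j → E G i j → E H (f i) (f j))

-- The graph G(3t).  Vertex with index p (0-based) is v_{p+1} for p < 2t and
-- x_{p-2t+1} for p ≥ 2t; x_k (k = q ∸ 2t + 1) is joined to v_1..v_{2k},
-- i.e. to indices p < 2 * (q ∸ 2t) + 2.
EdgeGt : ℕ → ℕ → ℕ → Set
EdgeGt t p q =
    (p < 2 * t × q < 2 * t × p ≢ q)
  ⊎ (p < 2 * t × 2 * t ≤ q × p < 2 * (q ∸ 2 * t) + 2)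
  ⊎ (q < 2 * t × 2 * t ≤ p × q < 2 * (p ∸ 2 * t) + 2)

private
  EdgeGt-sym : ∀ t p q → EdgeGt t p q → EdgeGt t q p
  EdgeGt-sym t p q (inj₁ (a , b , c)) = inj₁ (b , a , λ e → c (sym e))
  EdgeGt-sym t p q (inj₂ (inj₁ x)) = inj₂ (inj₂ x)
  EdgeGt-sym t p q (inj₂ (inj₂ x)) = inj₂ (inj₁ x)

  EdgeGt-irr : ∀ t p → ¬ EdgeGt t p p
  EdgeGt-irr t p (inj₁ (_ , _ , c)) = c refl
  EdgeGt-irr t p (inj₂ (inj₁ (a , b , _))) = ≤⇒≯ b a
  EdgeGt-irr t p (inj₂ (inj₂ (a , b , _))) = ≤⇒≯ b a

G3t : (t : ℕ) → Graph (3 * t)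
G3t t = record
  { E     = λ i j → EdgeGt t (toℕ i) (toℕ j)
  ; E-sym = λ {i} {j} → EdgeGt-sym t (toℕ i) (toℕ j)
  ; E-irr = λ i → EdgeGt-irr t (toℕ i)
  }

module Submission where

-- The only property of 2-trees the argument uses is 2-degeneracy: there is a
-- ranking of the vertices in which every vertex has at most two neighbours of
-- rank at most its own.  (Ranks are assigned in the order in which the 2-tree
-- is built; the last vertex added has its two attachment vertices as only
-- neighbours.)  We prove the stronger statement that every 2-degenerate graph
-- on 3t vertices embeds into G(3t), by induction on t:  let y be a vertex of
-- maximum rank, so all neighbours of y lie among its two lower neighbours a, b.
-- Delete y, a, b; the remaining 3(t-1) vertices are still 2-degenerate and
-- embed into G(3(t-1)) by induction.  Shifting that copy (v_i ↦ v_{i+2},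
-- x_k ↦ x_{k+1}) frees v_1, v_2 and x_1 of G(3t); put a at v_1, b at v_2 —
-- both adjacent to all other vertices — and y at x_1, whose neighbours are
-- exactly v_1, v_2.

open import Defs
open import Data.Nat using (ℕ; zero; suc; _+_; _*_; _∸_; _≤_; _<_; z≤n; s≤s; _<?_)
open import Data.Nat.Properties
  using (≤-refl; ≤-trans; <⇒≤; ≤⇒≯; <-irrefl; suc-injective; *-suc; +-∸-assoc; n∸n≡0; m≤n⇒m≤1+n; n≤1+n; m≤m+n; m≤n+m; ≮⇒≥; ≤-totalOrder)
open import Data.Fin using (Fin; toℕ; punchIn; punchOut; fromℕ<) renaming (zero to fz; suc to fs)
open import Data.Fin.Properties
  using (_≟_; punchInᵢ≢i; punchOut-cong; punchOut-punchIn; punchIn-punchOut; toℕ-fromℕ<; toℕ<n)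
open import Data.Vec.Functional using (insertAt)
open import Data.Vec.Functional.Properties using (insertAt-lookup; insertAt-punchIn)
open import Data.List using (allFin)
open import Data.List.Relation.Unary.All using (lookup)
open import Data.List.Membership.Propositional.Properties using (∈-allFin)
open import Data.List.Extrema ≤-totalOrder using (argmax; f[xs]≤f[argmax])
open import Data.Product using (Σ; _,_; proj₁; proj₂)
open import Data.Sum using (_⊎_; inj₁; inj₂) renaming (map to ⊎-map)
open import Data.Empty using (⊥-elim)
open import Function using (_∘_)
open import Relation.Nullary using (yes; no)
open import Relation.Binary.PropositionalEquality using (_≡_; _≢_; refl; sym; trans; cong; subst; subst₂)

data Around {n} (v : Fin (suc n)) : Fin (suc n) → Set where
  here  : Around v v
  there : (u : Fin n) → Around v (punchIn v u)

around : ∀ {n} (v u : Fin (suc n)) → Around v u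
around v u with v ≟ u
... | yes refl = here
... | no v≢u = subst (Around v) (punchIn-punchOut v≢u) (there (punchOut v≢u))

-- A total left inverse of punchIn v, sending v itself to the default d.
punchOutOr : ∀ {n} → Fin (suc n) → Fin n → Fin (suc n) → Fin n
punchOutOr v d x with v ≟ x
... | yes _ = d
... | no v≢x = punchOut v≢x

punchOutOr-punchIn : ∀ {n} (v : Fin (suc n)) (d u : Fin n) → punchOutOr v d (punchIn v u) ≡ u
punchOutOr-punchIn v d u with v ≟ punchIn v u
... | yes v≡u = ⊥-elim (punchInᵢ≢i v u (sym v≡u))
... | no _ = trans (punchOut-cong v refl) (punchOut-punchIn v)

pull-back : ∀ {n} (v : Fin (suc n)) (d : Fin n) {w x} → punchIn v w ≡ x → w ≡ punchOutOr v d x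
pull-back v d {w} refl = sym (punchOutOr-punchIn v d w)

insertAt-cases : ∀ {n} {A : Set} (g : Fin n → A) (v : Fin (suc n)) (c : A) (d : Fin n) (x : Fin (suc n)) →
                 insertAt g v c x ≡ c ⊎ insertAt g v c x ≡ g (punchOutOr v d x)
insertAt-cases g v c d x with around v x
... | here = inj₁ (insertAt-lookup g v c)
... | there u = inj₂ (trans (insertAt-punchIn g v c u) (cong g (sym (punchOutOr-punchIn v d u))))

insertAt-all : ∀ {n} {A : Set} (P : A → Set) (g : Fin n → A) (v : Fin (suc n)) (c : A) →
               P c → (∀ u → P (g u)) → ∀ x → P (insertAt g v c x)
insertAt-all P g v c pc pg x with around v x
... | here = subst P (sym (insertAt-lookup g v c)) pc
... | there u = subst P (sym (insertAt-punchIn g v c u)) (pg u)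

record TwoDegenerate {n} (H : Graph n) : Set where
  field
    rank         : Fin n → ℕ
    lower₁       : Fin n → Fin n
    lower₂       : Fin n → Fin n
    lower-covers : ∀ u w → E H u w → rank w ≤ rank u → w ≡ lower₁ u ⊎ w ≡ lower₂ u
open TwoDegenerate

delete-degenerate : ∀ {n} (H : Graph (suc n)) (v : Fin (suc n)) → TwoDegenerate H → TwoDegenerate (delete H v)
delete-degenerate H v D = record
  { rank         = rank D ∘ punchIn v
  ; lower₁       = λ u → punchOutOr v u (lower₁ D (punchIn v u))
  ; lower₂       = λ u → punchOutOr v u (lower₂ D (punchIn v u))
  ; lower-covers = λ u w e w≤u → ⊎-map (pull-back v u) (pull-back v u) (lower-covers D _ _ e w≤u)
  }

RankedDegenerate : ∀ {n} → Graph n → Set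
RankedDegenerate {n} H = Σ (TwoDegenerate H) λ D → ∀ u → rank D u < n

triangle-covers : (G : Graph 3) → ∀ u w → E G u w → toℕ w ≤ toℕ u → w ≡ fz ⊎ w ≡ fs fz
triangle-covers G u fz           e _ = inj₁ refl
triangle-covers G u (fs fz)      e _ = inj₂ refl
triangle-covers G fz (fs (fs fz)) e ()
triangle-covers G (fs fz) (fs (fs fz)) e (s≤s ())
triangle-covers G (fs (fs fz)) (fs (fs fz)) e _ = ⊥-elim (E-irr G _ e)

-- 2-trees are 2-degenerate: rank the vertices in order of construction; the
-- vertex v added last gets the top rank and its two neighbours as lower ones.
twoTree-ranked : ∀ {n} {G : Graph n} → TwoTree G → RankedDegenerate G
twoTree-ranked (isK3 G _) =
  record { rank = toℕ ; lower₁ = λ _ → fz ; lower₂ = λ _ → fs fz ; lower-covers = triangle-covers G } , toℕ<n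
twoTree-ranked (step {n} G v a b (_ , _ , _ , v-nbrs) _ rest) = D′ , rank′<
  where
  D : TwoDegenerate (delete G v)
  D = proj₁ (twoTree-ranked rest)
  rank< : ∀ u → rank D u < n
  rank< = proj₂ (twoTree-ranked rest)
  rank′ : Fin (suc n) → ℕ
  rank′ = insertAt (rank D) v n
  low₁ low₂ : Fin (suc n) → Fin (suc n)
  low₁ = insertAt (punchIn v ∘ lower₁ D) v a
  low₂ = insertAt (punchIn v ∘ lower₂ D) v b
  covers : ∀ u w → E G u w → rank′ w ≤ rank′ u → w ≡ low₁ u ⊎ w ≡ low₂ u
  covers u w e w≤u with around v u | around v w
  ... | here | _
    rewrite insertAt-lookup (punchIn v ∘ lower₁ D) v a | insertAt-lookup (punchIn v ∘ lower₂ D) v b = v-nbrs w e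
  ... | there u′ | here
    rewrite insertAt-lookup (rank D) v n | insertAt-punchIn (rank D) v n u′ = ⊥-elim (≤⇒≯ w≤u (rank< u′))
  ... | there u′ | there w′
    rewrite insertAt-punchIn (rank D) v n u′ | insertAt-punchIn (rank D) v n w′
          | insertAt-punchIn (punchIn v ∘ lower₁ D) v a u′ | insertAt-punchIn (punchIn v ∘ lower₂ D) v b u′
    = ⊎-map (cong (punchIn v)) (cong (punchIn v)) (lower-covers D u′ w′ e w≤u)
  D′ : TwoDegenerate G
  D′ = record { rank = rank′ ; lower₁ = low₁ ; lower₂ = low₂ ; lower-covers = covers }
  rank′< : ∀ u → rank′ u < suc n
  rank′< = insertAt-all (_< suc n) (rank D) v n ≤-refl (m≤n⇒m≤1+n ∘ rank<)

edgeGt-sym : ∀ t p q → EdgeGt t p q → EdgeGt t q p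
edgeGt-sym t p q (inj₁ (p< , q< , p≢q)) = inj₁ (q< , p< , p≢q ∘ sym)
edgeGt-sym t p q (inj₂ (inj₁ vx))       = inj₂ (inj₂ vx)
edgeGt-sym t p q (inj₂ (inj₂ xv))       = inj₂ (inj₁ xv)

record Embedding (t : ℕ) {n} (H : Graph n) : Set where
  field
    place           : Fin n → ℕ
    place-<         : ∀ u → place u < 3 * t
    place-injective : ∀ u w → place u ≡ place w → u ≡ w
    place-edge      : ∀ u w → E H u w → EdgeGt t (place u) (place w)
open Embedding

extend : ∀ {t n} (H : Graph (suc n)) (v : Fin (suc n)) (g : Embedding t (delete H v)) (c : ℕ) →
         c < 3 * t → (∀ u → place g u ≢ c) → (∀ w → E H v (punchIn v w) → EdgeGt t c (place g w)) →
         Embedding t H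
extend {t} {n} H v g c c< fresh adjacent = record
  { place           = f
  ; place-<         = insertAt-all (_< 3 * t) (place g) v c c< (place-< g)
  ; place-injective = injective
  ; place-edge      = edge
  }
  where
  f : Fin (suc n) → ℕ
  f = insertAt (place g) v c
  injective : ∀ u w → f u ≡ f w → u ≡ w
  injective u w fu≡fw with around v u | around v w
  ... | here | here = refl
  ... | here | there w′
    rewrite insertAt-lookup (place g) v c | insertAt-punchIn (place g) v c w′ = ⊥-elim (fresh w′ (sym fu≡fw))
  ... | there u′ | here
    rewrite insertAt-lookup (place g) v c | insertAt-punchIn (place g) v c u′ = ⊥-elim (fresh u′ fu≡fw)
  ... | there u′ | there w′
    rewrite insertAt-punchIn (place g) v c u′ | insertAt-punchIn (place g) v c w′ =
    cong (punchIn v) (place-injective g u′ w′ fu≡fw)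
  edge : ∀ u w → E H u w → EdgeGt t (f u) (f w)
  edge u w e with around v u | around v w
  ... | here | here = ⊥-elim (E-irr H v e)
  ... | here | there w′
    rewrite insertAt-lookup (place g) v c | insertAt-punchIn (place g) v c w′ = adjacent w′ e
  ... | there u′ | here
    rewrite insertAt-lookup (place g) v c | insertAt-punchIn (place g) v c u′ =
    edgeGt-sym t _ _ (adjacent u′ (E-sym H e))
  ... | there u′ | there w′
    rewrite insertAt-punchIn (place g) v c u′ | insertAt-punchIn (place g) v c w′ = place-edge g u′ w′ e

-- The hubs of G(3t+3): v_1 and v_2, with indices 0 and 1, and x_1, with index
-- 2(t+1), which is adjacent exactly to v_1 and v_2.

<2⇒<2T : ∀ t {c} → c < 2 → c < 2 * suc t
<2⇒<2T t {c} c<2 = subst (c <_) (sym (*-suc 2 t)) (≤-trans c<2 (m≤m+n 2 (2 * t)))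

x₁<3T : ∀ t → 2 * suc t < 3 * suc t
x₁<3T t = subst₂ _<_ (sym (*-suc 2 t)) (sym (*-suc 3 t)) (s≤s (s≤s (s≤s (m≤n+m (2 * t) t))))

hub<3T : ∀ t {c} → c < 2 → c < 3 * suc t
hub<3T t c<2 = ≤-trans (<2⇒<2T t c<2) (<⇒≤ (x₁<3T t))

hub≢x₁ : ∀ t {c} → c < 2 → c ≢ 2 * suc t
hub≢x₁ t c<2 c≡x₁ = <-irrefl c≡x₁ (<2⇒<2T t c<2)

hub≢ : ∀ {c x} → c < 2 → 2 ≤ x → x ≢ c
hub≢ c<2 2≤x x≡c = ≤⇒≯ 2≤x (subst (_< 2) (sym x≡c) c<2)

hub-adjacent : ∀ t c x → c < 2 → c ≢ x → EdgeGt (suc t) c x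
hub-adjacent t c x c<2 c≢x with x <? 2 * suc t
... | yes x<2T = inj₁ (<2⇒<2T t c<2 , x<2T , c≢x)
... | no x≮2T  = inj₂ (inj₁ (<2⇒<2T t c<2 , ≮⇒≥ x≮2T , ≤-trans c<2 (m≤n+m 2 _)))

x₁-adjacent : ∀ t c → c < 2 → EdgeGt (suc t) (2 * suc t) c
x₁-adjacent t c c<2 =
  inj₂ (inj₂ (<2⇒<2T t c<2 , ≤-refl , subst (λ k → c < 2 * k + 2) (sym (n∸n≡0 (2 * suc t))) c<2))

-- Shifting G(3t) into G(3t+3): v_i ↦ v_{i+2} and x_k ↦ x_{k+1}.  The image
-- avoids v_1, v_2, x_1 and the shift preserves edges, since x_{k+1} sees
-- v_1, ..., v_{2k+2}.

shift : ℕ → ℕ → ℕ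
shift t z with z <? 2 * t
... | yes _ = 2 + z
... | no _  = 3 + z

shift-v : ∀ t z → z < 2 * t → shift t z ≡ 2 + z
shift-v t z z<2t with z <? 2 * t
... | yes _    = refl
... | no z≮2t  = ⊥-elim (z≮2t z<2t)

shift-x : ∀ t z → 2 * t ≤ z → shift t z ≡ 3 + z
shift-x t z 2t≤z with z <? 2 * t
... | yes z<2t = ⊥-elim (≤⇒≯ 2t≤z z<2t)
... | no _     = refl

shift-<2T : ∀ t {z} → z < 2 * t → 2 + z < 2 * suc t
shift-<2T t {z} z<2t = subst (2 + z <_) (sym (*-suc 2 t)) (s≤s (s≤s z<2t))

shift-vx-edge : ∀ t p q → p < 2 * t → 2 * t ≤ q → p < 2 * (q ∸ 2 * t) + 2 → EdgeGt (suc t) (shift t p) (shift t q)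
shift-vx-edge t p q p<2t 2t≤q p<2k+2 rewrite shift-v t p p<2t | shift-x t q 2t≤q =
  inj₂ (inj₁ (shift-<2T t p<2t , 2T≤3+q , subst (λ k → 2 + p < 2 * k + 2) (sym next-index) p+2<2k+4))
  where
  2T≤3+q : 2 * suc t ≤ 3 + q
  2T≤3+q = subst (_≤ 3 + q) (sym (*-suc 2 t)) (s≤s (s≤s (m≤n⇒m≤1+n 2t≤q)))
  next-index : 3 + q ∸ 2 * suc t ≡ suc (q ∸ 2 * t)
  next-index = trans (cong (3 + q ∸_) (*-suc 2 t)) (+-∸-assoc 1 2t≤q)
  p+2<2k+4 : 2 + p < 2 * suc (q ∸ 2 * t) + 2
  p+2<2k+4 = subst (λ m → 2 + p < m + 2) (sym (*-suc 2 (q ∸ 2 * t))) (s≤s (s≤s p<2k+2))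

shift-edge : ∀ t p q → EdgeGt t p q → EdgeGt (suc t) (shift t p) (shift t q)
shift-edge t p q (inj₁ (p<2t , q<2t , p≢q)) rewrite shift-v t p p<2t | shift-v t q q<2t =
  inj₁ (shift-<2T t p<2t , shift-<2T t q<2t , p≢q ∘ suc-injective ∘ suc-injective)
shift-edge t p q (inj₂ (inj₁ (p<2t , 2t≤q , adj))) = shift-vx-edge t p q p<2t 2t≤q adj
shift-edge t p q (inj₂ (inj₂ (q<2t , 2t≤p , adj))) = edgeGt-sym (suc t) _ _ (shift-vx-edge t q p q<2t 2t≤p adj)

shift-< : ∀ t z → z < 3 * t → shift t z < 3 * suc t
shift-< t z z<3t with z <? 2 * t
... | yes _ = subst (2 + z <_) (sym (*-suc 3 t)) (s≤s (s≤s (s≤s (<⇒≤ z<3t))))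
... | no _  = subst (3 + z <_) (sym (*-suc 3 t)) (s≤s (s≤s (s≤s z<3t)))

2≤shift : ∀ t z → 2 ≤ shift t z
2≤shift t z with z <? 2 * t
... | yes _ = s≤s (s≤s z≤n)
... | no _  = s≤s (s≤s z≤n)

shift≢x₁ : ∀ t z → shift t z ≢ 2 * suc t
shift≢x₁ t z with z <? 2 * t
... | yes z<2t = λ eq → <-irrefl (suc-injective (suc-injective (trans eq (*-suc 2 t)))) z<2t
... | no z≮2t  = λ eq → z≮2t (subst (suc z ≤_) (suc-injective (suc-injective (trans eq (*-suc 2 t)))) ≤-refl)

shift-injective : ∀ t p q → shift t p ≡ shift t q → p ≡ q
shift-injective t p q eq with p <? 2 * t | q <? 2 * t
... | yes _    | yes _    = suc-injective (suc-injective eq)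
... | no _     | no _     = suc-injective (suc-injective (suc-injective eq))
... | yes p<2t | no q≮2t  = ⊥-elim (q≮2t (≤-trans (n≤1+n _) (subst (_< 2 * t) (suc-injective (suc-injective eq)) p<2t)))
... | no p≮2t  | yes q<2t = ⊥-elim (p≮2t (≤-trans (n≤1+n _) (subst (_< 2 * t) (sym (suc-injective (suc-injective eq))) q<2t)))

shifted : ∀ {t n} {H : Graph n} → Embedding t H → Embedding (suc t) H
shifted {t} g = record
  { place           = shift t ∘ place g
  ; place-<         = λ u → shift-< t _ (place-< g u)
  ; place-injective = λ u w eq → place-injective g u w (shift-injective t _ _ eq)
  ; place-edge      = λ u w e → shift-edge t _ _ (place-edge g u w e)
  }

shifted-≥2 : ∀ {t n} {H : Graph n} (g : Embedding t H) → ∀ u → 2 ≤ place (shifted g) u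
shifted-≥2 {t} g u = 2≤shift t (place g u)

shifted-≢x₁ : ∀ {t n} {H : Graph n} (g : Embedding t H) → ∀ u → place (shifted g) u ≢ 2 * suc t
shifted-≢x₁ {t} g u = shift≢x₁ t (place g u)

extend-at-hub : ∀ {t n} (H : Graph (suc n)) (v : Fin (suc n)) (g : Embedding (suc t) (delete H v)) (c : ℕ) →
                c < 2 → (∀ u → place g u ≢ c) → Embedding (suc t) H
extend-at-hub {t} H v g c c<2 fresh =
  extend H v g c (hub<3T t c<2) fresh (λ w _ → hub-adjacent t c (place g w) c<2 (fresh w ∘ sym))

placed-on-hubs : ∀ {n} (g : Fin n → ℕ) (a x : Fin (suc (suc n))) (d : Fin (suc n)) →
                 insertAt (insertAt g (punchOutOr a d x) 1) a 0 x < 2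
placed-on-hubs g a x d with insertAt-cases (insertAt g (punchOutOr a d x) 1) a 0 d x
... | inj₁ at0 = subst (_< 2) (sym at0) (s≤s z≤n)
... | inj₂ at1 = subst (_< 2) (sym (trans at1 (insertAt-lookup g (punchOutOr a d x) 1))) ≤-refl

-- Every ranking of a nonempty finite vertex set attains its maximum.  Only
-- this property is used, so the argmax computation is kept opaque.
opaque
  maximum : ∀ {n} (r : Fin (suc n) → ℕ) → Σ (Fin (suc n)) λ y → ∀ u → r u ≤ r y
  maximum r = argmax r fz (allFin _) , λ u → lookup (f[xs]≤f[argmax] {f = r} fz (allFin _)) (∈-allFin u)

-- The number 3t, unfolded so that 3(t+1) visibly has three more vertices.
thrice : ℕ → ℕ
thrice zero    = zero
thrice (suc t) = suc (suc (suc (thrice t)))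

thrice≡3* : ∀ t → thrice t ≡ 3 * t
thrice≡3* zero    = refl
thrice≡3* (suc t) = trans (cong (3 +_) (thrice≡3* t)) (sym (*-suc 3 t))

embed : ∀ t (H : Graph (thrice t)) → TwoDegenerate H → Embedding t H
embed zero    H D = record { place = λ () ; place-< = λ () ; place-injective = λ () ; place-edge = λ () }
embed (suc t) H D with maximum (rank D)
... | y , y-max = extend H y E₁ (2 * suc t) (x₁<3T t) x₁-fresh (λ w e → x₁-adjacent t (place E₁ w) (y-nbr-on-hub w e))
  where
  a a′ : Fin (suc (suc (thrice t)))
  a  = punchOutOr y fz (lower₁ D y)
  a′ = punchOutOr y fz (lower₂ D y)
  b : Fin (suc (thrice t))
  b = punchOutOr a fz a′
  H₁ : Graph (suc (suc (thrice t)))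
  H₁ = delete H y
  H₂ : Graph (suc (thrice t))
  H₂ = delete H₁ a
  rest : Embedding t (delete H₂ b)
  rest = embed t (delete H₂ b) (delete-degenerate H₂ b (delete-degenerate H₁ a (delete-degenerate H y D)))
  E₃ : Embedding (suc t) (delete H₂ b)
  E₃ = shifted rest
  E₂ : Embedding (suc t) H₂
  E₂ = extend-at-hub H₂ b E₃ 1 ≤-refl (λ u → hub≢ ≤-refl (shifted-≥2 rest u))
  v₁-fresh : ∀ u → place E₂ u ≢ 0
  v₁-fresh = insertAt-all (_≢ 0) (place E₃) b 1 (λ ()) (λ u → hub≢ (s≤s z≤n) (shifted-≥2 rest u))
  E₁ : Embedding (suc t) H₁
  E₁ = extend-at-hub H₁ a E₂ 0 (s≤s z≤n) v₁-fresh
  x₁-fresh : ∀ u → place E₁ u ≢ 2 * suc t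
  x₁-fresh = insertAt-all (_≢ 2 * suc t) (place E₂) a 0 (hub≢x₁ t (s≤s z≤n))
               (insertAt-all (_≢ 2 * suc t) (place E₃) b 1 (hub≢x₁ t ≤-refl) (shifted-≢x₁ rest))
  -- Every neighbour of y is a or a′, hence placed at v_1 or v_2.
  y-nbr-on-hub : ∀ w → E H y (punchIn y w) → place E₁ w < 2
  y-nbr-on-hub w e with lower-covers D y (punchIn y w) e (y-max _)
  ... | inj₁ w≡ℓ₁ = subst (λ x → place E₁ x < 2) (sym (pull-back y fz w≡ℓ₁))
                      (subst (_< 2) (sym (insertAt-lookup (place E₂) a 0)) (s≤s z≤n))
  ... | inj₂ w≡ℓ₂ = subst (λ x → place E₁ x < 2) (sym (pull-back y fz w≡ℓ₂)) (placed-on-hubs (place E₃) a a′ fz)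

embed-3t : ∀ t {n} → thrice t ≡ n → (H : Graph n) → TwoDegenerate H → Embedding t H
embed-3t t refl = embed t

toSubgraph : ∀ t {n} {G : Graph n} → Embedding t G → SubgraphOf G (G3t t)
toSubgraph t {n} g = vertex , injective , λ i j e → subst₂ (EdgeGt t) (sym (index i)) (sym (index j)) (place-edge g i j e)
  where
  vertex : Fin n → Fin (3 * t)
  vertex u = fromℕ< (place-< g u)
  index : ∀ u → toℕ (vertex u) ≡ place g u
  index u = toℕ-fromℕ< (place-< g u)
  injective : ∀ {u w} → vertex u ≡ vertex w → u ≡ w
  injective {u} {w} eq = place-injective g u w (trans (sym (index u)) (trans (cong toℕ eq) (index w)))

lemma4p1p2 : (t : ℕ) → 1 ≤ t → (G : Graph (3 * t)) → TwoTree G → SubgraphOf G (G3t t)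
lemma4p1p2 t _ G twoTree = toSubgraph t (embed-3t t (thrice≡3* t) G (proj₁ (twoTree-ranked twoTree)))
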